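{- Let $0\leq\ell\leq k-1$ and let $Q$ be a cube on scale $\ell$ in $R^n$. Let $L,L'$ be two lines in $R^n$ with the same direction $b\in\mathbb{P}R^{n-1}$, both intersecting $Q$. Then for every $f\in\Omega^n_{p^k-1}$, $$\sum_{x\in L\cap Q}f(x)\equiv\sum_{x\in L'\cap Q}f(x)\pmod p.$$
   Context: Let $p$ be prime, $k,n\in\mathbb{N}$, $R=\mathbb{Z}/p^k\mathbb{Z}$ with representatives $\{0,\dots,p^k-1\}$, $[m]=\{0,\dots,m-1\}$. For $j\in[p^k]$, $\phi_j(x)=\binom{x}{j}\bmod p$ (representative of $x$, $\binom{a}{b}=0$ for $a<b$); for $\alpha\in[p^k]^n$, $\phi_\alpha(x)=\prod_i\phi_{\alpha_i}(x_i)$, $|\alpha|=\sum_i\alpha_i$; $\Omega^n_N=\operatorname{span}_{\mathbb{Z}/p\mathbb{Z}}\{\phi_\alpha:|\alpha|\le N\}$, functions $R^n\to\mathbb{Z}/p\mathbb{Z}$. $\mathbb{P}R^{n-1}$: vectors of $R^n$ with at least one invertible coordinate modulo multiplication by $R^\times$. A line in direction $b$ is $\{a+tb:t\in R\}$ for some $a\in R^n$. A cube on scale $\ell$ is $\{y\in R^n:y\equiv x\bmod p^\ell\text{ coordinatewise}\}$ for some $x\in R^n$. -}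

module Defs where

open import Data.Nat using (ℕ; zero; suc; _+_; _*_; _^_; _≤_; _<_; _%_; NonZero)
open import Data.Nat.Properties using (m^n≢0; _≟_)
open import Data.Nat.Combinatorics using (_C_)
open import Data.Bool using (Bool; true; _∧_)
open import Data.Bool.ListAction using (any)
open import Data.List using (List; []; _∷_; map; concatMap; upTo; filterᵇ)
open import Data.Nat.ListAction using (sum)
open import Data.List.Relation.Unary.All as LAll using ()
open import Data.Vec as Vec using (Vec; []; _∷_; zipWith; foldr)
open import Data.Vec.Relation.Unary.All as VAll using ()
open import Data.Vec.Relation.Unary.Any as VAny using ()
open import Data.Vec.Properties using (≡-dec)
open import Data.Product using (_×_; _,_; ∃; Σ)
open import Relation.Binary.PropositionalEquality using (_≡_)
open import Relation.Nullary using (¬_; ⌊_⌋)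
open import Data.Nat.Divisibility using (_∣_)

-- Points of R^n, R = ℤ/p^kℤ, are vectors of representatives in {0,…,p^k-1}.
IsPoint : (p k n : ℕ) → Vec ℕ n → Set
IsPoint p k n x = VAll.All (λ xi → xi < p ^ k) x

allVecs : (m n : ℕ) → List (Vec ℕ n)
allVecs m zero = [] ∷ []
allVecs m (suc n) = concatMap (λ i → map (i ∷_) (allVecs m n)) (upTo m)

-- b ∈ R^n has at least one invertible coordinate (i.e. one not divisible by p).
HasUnitCoord : (p n : ℕ) → Vec ℕ n → Set
HasUnitCoord p n b = VAny.Any (λ bi → ¬ (p ∣ bi)) b

linePt : (p k : ℕ) .{{_ : NonZero p}} → {n : ℕ} → Vec ℕ n → Vec ℕ n → ℕ → Vec ℕ n
linePt p k a b t = zipWith (λ ai bi → (ai + t * bi) % (p ^ k)) a b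
  where instance _ = m^n≢0 p k

onLine : (p k : ℕ) .{{_ : NonZero p}} → {n : ℕ} → (a b x : Vec ℕ n) → Bool
onLine p k a b x = any (λ t → ⌊ ≡-dec _≟_ x (linePt p k a b t) ⌋) (upTo (p ^ k))

-- y lies in the cube on scale ℓ containing c: y ≡ c mod p^ℓ coordinatewise
inCube : (p ℓ : ℕ) .{{_ : NonZero p}} → {n : ℕ} → (c y : Vec ℕ n) → Bool
inCube p ℓ c y = foldr _ _∧_ true
                   (zipWith (λ ci yi → ⌊ (ci % (p ^ ℓ)) ≟ (yi % (p ^ ℓ)) ⌋) c y)
  where instance _ = m^n≢0 p ℓ

sumLineCube : (p k ℓ : ℕ) .{{_ : NonZero p}} → {n : ℕ} → (a b c : Vec ℕ n) →
              (Vec ℕ n → ℕ) → ℕ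
sumLineCube p k ℓ {n} a b c f =
  sum (map f (filterᵇ (λ x → onLine p k a b x ∧ inCube p ℓ c x) (allVecs (p ^ k) n)))

φ : (p : ℕ) .{{_ : NonZero p}} → ℕ → ℕ → ℕ
φ p j x = (x C j) % p

φα : (p : ℕ) .{{_ : NonZero p}} → {n : ℕ} → Vec ℕ n → Vec ℕ n → ℕ
φα p α x = foldr _ _*_ 1 (zipWith (λ αi xi → φ p αi xi) α x)

∣_∣ₘ : {n : ℕ} → Vec ℕ n → ℕ
∣ α ∣ₘ = foldr _ _+_ 0 α

-- a finite Z/pZ-linear combination Σ c · φ_α, given as a list of (c, α)
evalComb : (p : ℕ) .{{_ : NonZero p}} → {n : ℕ} → List (ℕ × Vec ℕ n) → Vec ℕ n → ℕ
evalComb p terms x = sum (map (λ { (c , α) → c * φα p α x }) terms)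

-- f ∈ Ω^n_N: f agrees (mod p, on R^n) with a Z/pZ-linear combination of φ_α,
-- α ∈ [p^k]^n, |α| ≤ N
InΩ : (p k n N : ℕ) .{{_ : NonZero p}} → (Vec ℕ n → ℕ) → Set
InΩ p k n N f =
  Σ (List (ℕ × Vec ℕ n)) λ terms →
    LAll.All (λ { (c , α) → IsPoint p k n α × ∣ α ∣ₘ ≤ N }) terms ×
    ((x : Vec ℕ n) → IsPoint p k n x → f x % p ≡ evalComb p terms x % p)

-- Let P = p^ℓ and M = p^(k-ℓ). Since b has a unit coordinate, a line through the point a + t₀b of
-- the cube meets it in exactly the M points a + (r + Ps)b, s < M, where r = t₀ mod P; so the sum of
-- φ_α over L ∩ Q is Σ_{s<M} Π_i binom(y_i + P s b_i, α_i) with y = a + rb ≡ c (mod P).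
-- Modulo p one has binom(x + P, j) ≡ binom(x, j) + binom(x, j - P), and
-- s ↦ binom(y_i + P s b_i, j) is a polynomial of degree at most ⌊j/P⌋. Hence moving y_i by P changes
-- the sum by the sum over s < M of a polynomial of degree ≤ Σ_i ⌊α_i/P⌋ ≤ |α|/P < M, which vanishes
-- modulo p because p divides binom(M, i) for 0 < i < M (Newton's forward-difference formula).
-- So the sum depends only on y modulo P, that is, only on the cube and not on the line.
module Submission where

open import Defs

open import Data.Nat
open import Data.Nat.Properties
open import Data.Nat.DivMod
open import Data.Nat.Divisibility
open import Data.Nat.Primality using (Prime; prime⇒nonZero; euclidsLemma)
open import Data.Nat.Combinatorics using (_C_; nCk+nC[k+1]≡[n+1]C[k+1]; nCn≡1; nC1≡n)
open import Data.Nat.Combinatorics.Specification using (k>n⇒nCk≡0)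
open import Data.Nat.Solver using (module +-*-Solver)
open import Data.Product using (Σ; ∃; _×_; _,_; proj₁; proj₂)
open import Data.Vec as Vec using (Vec; []; _∷_)
open import Data.Vec.Properties using (∷-injective)
import Data.Vec.Relation.Unary.All as VAll
open import Data.List as List using (List; []; _∷_; upTo; filterᵇ; cartesianProductWith)
open import Data.List.Properties using (applyUpTo-∷ʳ; map-applyUpTo)
open import Data.Nat.ListAction using (sum)
open import Data.Nat.ListAction.Properties using (sum-++; sum-↭)
open import Data.List.Membership.Propositional using (_∈_; find; lose)
open import Data.List.Membership.Propositional.Properties
  using (∈-upTo⁺; ∈-upTo⁻; ∈-applyUpTo⁺; ∈-applyUpTo⁻; ∈-cartesianProductWith⁺;
         ∈-filter⁺; ∈-filter⁻)
open import Data.List.Membership.Propositional.Properties.WithK using (unique∧set⇒bag)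
open import Data.List.Relation.Binary.BagAndSetEquality using (∼bag⇒↭)
open import Data.List.Relation.Binary.Permutation.Propositional.Properties using () renaming (map⁺ to ↭-map⁺)
open import Data.List.Relation.Unary.Unique.Propositional using (Unique)
import Data.List.Relation.Unary.Unique.Propositional.Properties as Unique
import Data.List.Relation.Unary.All as LAll
import Data.List.Relation.Unary.AllPairs as AllPairs
import Data.List.Relation.Unary.Any as LAny
open import Data.List.Relation.Unary.Any.Properties using (any⁺; any⁻)
import Data.Vec.Relation.Unary.Any as VAny
open import Data.Bool using (Bool; T; _∧_)
open import Data.Bool.Properties using (T-∧; T?)
open import Relation.Nullary.Decidable using (toWitness; fromWitness)
open import Function.Bundles using (_⇔_; mk⇔; Equivalence)
open import Data.Vec.Relation.Binary.Pointwise.Inductive as Pointwise using (Pointwise; []; _∷_)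
open import Data.Sum using (_⊎_; inj₁; inj₂) renaming ([_,_]′ to ⊎-elim)
open import Data.Empty using (⊥-elim)
open import Function using (_on_; _∘_)
open import Relation.Nullary using (¬_; yes; no)
open import Relation.Binary using (Setoid)
import Relation.Binary.Construct.On as On
import Relation.Binary.Reasoning.Setoid as SetoidReasoning
open import Relation.Binary.PropositionalEquality

open import Algebra.Properties.CommutativeSemigroup +-commutativeSemigroup using (interchange)
open import Algebra.Properties.CommutativeSemigroup *-commutativeSemigroup using (xy∙z≈xz∙y)
open +-*-Solver using (solve; _:+_; _:*_; _:=_; con)

sumBelow : ℕ → (ℕ → ℕ) → ℕ
sumBelow zero    f = 0
sumBelow (suc n) f = sumBelow n f + f n

syntax sumBelow n (λ i → f) = ∑[ i < n ] f

sumBelow-cong : ∀ n {f g} → (∀ i → i < n → f i ≡ g i) → sumBelow n f ≡ sumBelow n g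
sumBelow-cong zero    eq = refl
sumBelow-cong (suc n) eq = cong₂ _+_ (sumBelow-cong n (λ i i<n → eq i (m<n⇒m<1+n i<n))) (eq n ≤-refl)

sumBelow-zero : ∀ n → ∑[ i < n ] 0 ≡ 0
sumBelow-zero zero    = refl
sumBelow-zero (suc n) = trans (+-identityʳ _) (sumBelow-zero n)

sumBelow-const : ∀ n c → ∑[ i < n ] c ≡ n * c
sumBelow-const zero    c = refl
sumBelow-const (suc n) c = trans (cong (_+ c) (sumBelow-const n c)) (+-comm (n * c) c)

sumBelow-+ : ∀ n f g → ∑[ i < n ] (f i + g i) ≡ sumBelow n f + sumBelow n g
sumBelow-+ zero    f g = refl
sumBelow-+ (suc n) f g =
  trans (cong (_+ (f n + g n)) (sumBelow-+ n f g)) (interchange (sumBelow n f) (sumBelow n g) (f n) (g n))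

sumBelow-*ˡ : ∀ n c f → ∑[ i < n ] (c * f i) ≡ c * sumBelow n f
sumBelow-*ˡ zero    c f = sym (*-zeroʳ c)
sumBelow-*ˡ (suc n) c f =
  trans (cong (_+ c * f n) (sumBelow-*ˡ n c f)) (sym (*-distribˡ-+ c (sumBelow n f) (f n)))

sumBelow-suc : ∀ n f → sumBelow (suc n) f ≡ f 0 + ∑[ i < n ] f (suc i)
sumBelow-suc zero    f = sym (+-identityʳ (f 0))
sumBelow-suc (suc n) f = trans (cong (_+ f (suc n)) (sumBelow-suc n f)) (+-assoc (f 0) _ _)

sumBelow-swap : ∀ n m (F : ℕ → ℕ → ℕ) → ∑[ i < n ] ∑[ j < m ] F i j ≡ ∑[ j < m ] ∑[ i < n ] F i j
sumBelow-swap zero    m F = sym (sumBelow-zero m)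
sumBelow-swap (suc n) m F = trans (cong (_+ sumBelow m (F n)) (sumBelow-swap n m F))
  (sym (sumBelow-+ m (λ j → ∑[ i < n ] F i j) (F n)))

binom : ℕ → ℕ → ℕ
binom n       zero    = 1
binom zero    (suc k) = 0
binom (suc n) (suc k) = binom n k + binom n (suc k)

binom≡C : ∀ n k → binom n k ≡ n C k
binom≡C n       zero    = refl
binom≡C zero    (suc k) = sym (k>n⇒nCk≡0 {0} {suc k} (s≤s z≤n))
binom≡C (suc n) (suc k) =
  trans (cong₂ _+_ (binom≡C n k) (binom≡C n (suc k))) (nCk+nC[k+1]≡[n+1]C[k+1] n k)

n<k⇒binom≡0 : ∀ {n k} → n < k → binom n k ≡ 0
n<k⇒binom≡0 {n} {k} n<k = trans (binom≡C n k) (k>n⇒nCk≡0 n<k)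

binom[n,n]≡1 : ∀ n → binom n n ≡ 1
binom[n,n]≡1 n = trans (binom≡C n n) (nCn≡1 n)

binom[n,1]≡n : ∀ n → binom n 1 ≡ n
binom[n,1]≡n n = trans (binom≡C n 1) (nC1≡n n)

binom-suc : ∀ n k .{{_ : NonZero k}} → binom (suc n) k ≡ binom n (pred k) + binom n k
binom-suc n (suc k) = refl

binom-pascal-+suc : ∀ n i j → binom (suc n) (i + suc j) ≡ binom n (i + j) + binom n (i + suc j)
binom-pascal-+suc n i j rewrite +-suc i j = refl

binom-absorption : ∀ n k → suc k * binom (suc n) (suc k) ≡ suc n * binom n k
binom-absorption n       zero    = trans (*-identityˡ _) (trans (binom[n,1]≡n (suc n)) (sym (*-identityʳ (suc n))))
binom-absorption zero    (suc k) = *-zeroʳ (2 + k)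
binom-absorption (suc n) (suc k) = begin
  (2 + k) * (binom (suc n) (suc k) + binom (suc n) (2 + k))
    ≡⟨ *-distribˡ-+ (2 + k) (binom (suc n) (suc k)) _ ⟩
  (2 + k) * binom (suc n) (suc k) + (2 + k) * binom (suc n) (2 + k)
    ≡⟨ cong ((2 + k) * binom (suc n) (suc k) +_) (binom-absorption n (suc k)) ⟩
  binom (suc n) (suc k) + (1 + k) * binom (suc n) (suc k) + (1 + n) * binom n (suc k)
    ≡⟨ cong (λ z → binom (suc n) (suc k) + z + (1 + n) * binom n (suc k)) (binom-absorption n k) ⟩
  binom (suc n) (suc k) + (1 + n) * binom n k + (1 + n) * binom n (suc k)
    ≡⟨ +-assoc (binom (suc n) (suc k)) _ _ ⟩
  binom (suc n) (suc k) + ((1 + n) * binom n k + (1 + n) * binom n (suc k))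
    ≡⟨ cong (binom (suc n) (suc k) +_) (*-distribˡ-+ (1 + n) (binom n k) _) ⟨
  (2 + n) * binom (suc n) (suc k)
    ∎
  where open ≡-Reasoning

hockey-stick : ∀ n k → ∑[ s < n ] binom s k ≡ binom n (suc k)
hockey-stick zero    k = refl
hockey-stick (suc n) k = trans (cong (_+ binom n k) (hockey-stick n k)) (+-comm (binom n (suc k)) (binom n k))

x+m*0≡x : ∀ x m → x + m * 0 ≡ x
x+m*0≡x x m = trans (cong (x +_) (*-zeroʳ m)) (+-identityʳ x)

x+m*[1+q]≡x+m*q+m : ∀ x m q → x + m * suc q ≡ x + m * q + m
x+m*[1+q]≡x+m*q+m x m q = solve 3 (λ x m q → x :+ m :* (con 1 :+ q) := x :+ m :* q :+ m) refl x m q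

module Congruence (m : ℕ) .{{_ : NonZero m}} where

  infix 4 _≈_
  _≈_ : ℕ → ℕ → Set
  _≈_ = _≡_ on (_% m)

  ≈-setoid : Setoid _ _
  ≈-setoid = On.setoid (setoid ℕ) (_% m)

  open Setoid ≈-setoid public using () renaming (refl to ≈-refl; sym to ≈-sym; trans to ≈-trans)
  module ≈-Reasoning = SetoidReasoning ≈-setoid

  ≡⇒≈ : ∀ {x y} → x ≡ y → x ≈ y
  ≡⇒≈ = cong (_% m)

  +-cong : ∀ {a a′ b b′} → a ≈ a′ → b ≈ b′ → a + b ≈ a′ + b′
  +-cong {a} {a′} {b} {b′} a≈a′ b≈b′ =
    trans (%-distribˡ-+ a b m)
      (trans (cong₂ (λ u v → (u + v) % m) a≈a′ b≈b′) (sym (%-distribˡ-+ a′ b′ m)))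

  *-cong : ∀ {a a′ b b′} → a ≈ a′ → b ≈ b′ → a * b ≈ a′ * b′
  *-cong {a} {a′} {b} {b′} a≈a′ b≈b′ =
    trans (%-distribˡ-* a b m)
      (trans (cong₂ (λ u v → (u * v) % m) a≈a′ b≈b′) (sym (%-distribˡ-* a′ b′ m)))

  %-≈ : ∀ x → x % m ≈ x
  %-≈ x = m%n%n≡m%n x m

  ∣⇒≈0 : ∀ {x} → m ∣ x → x ≈ 0
  ∣⇒≈0 {x} m∣x = trans (n∣m⇒m%n≡0 x m m∣x) (sym (n∣m⇒m%n≡0 0 m (m ∣0)))

  sumBelow-cong≈ : ∀ n {f g} → (∀ i → i < n → f i ≈ g i) → sumBelow n f ≈ sumBelow n g
  sumBelow-cong≈ zero    eq = refl
  sumBelow-cong≈ (suc n) eq = +-cong (sumBelow-cong≈ n (λ i i<n → eq i (m<n⇒m<1+n i<n))) (eq n ≤-refl)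

+-≡-mod⇒∣ : ∀ m .{{_ : NonZero m}} x z → (x + z) % m ≡ x % m → m ∣ z
+-≡-mod⇒∣ m x z eq = divides (y / m) (+-cancelˡ-≡ (x % m) z (y / m * m) (begin
  x % m + z              ≡⟨ m≡m%n+[m/n]*n y m ⟩
  y % m + y / m * m      ≡⟨ cong (_+ y / m * m) y%m≡x%m ⟩
  x % m + y / m * m      ∎))
  where
  open ≡-Reasoning
  y : ℕ
  y = x % m + z
  x+z≡y+[x/m]*m : x + z ≡ y + x / m * m
  x+z≡y+[x/m]*m = begin
    x + z                      ≡⟨ cong (_+ z) (m≡m%n+[m/n]*n x m) ⟩
    x % m + x / m * m + z      ≡⟨ solve 3 (λ a b c → a :+ b :+ c := a :+ c :+ b) refl (x % m) (x / m * m) z ⟩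
    y + x / m * m              ∎
  y%m≡x%m : y % m ≡ x % m
  y%m≡x%m = trans (sym ([m+kn]%n≡m%n y (x / m) m)) (trans (cong (_% m) (sym x+z≡y+[x/m]*m)) eq)

module PrimePower {p : ℕ} (p-prime : Prime p) where

  private instance
    p≢0 : NonZero p
    p≢0 = prime⇒nonZero p-prime

  p^e∣x*b⇒p^e∣x : ∀ e x {b} → ¬ p ∣ b → p ^ e ∣ x * b → p ^ e ∣ x
  p^e∣x*b⇒p^e∣x zero    x p∤b _ = 1∣ x
  p^e∣x*b⇒p^e∣x (suc e) x {b} p∤b p^[1+e]∣xb
    with euclidsLemma x b p-prime (∣-trans (m∣m*n (p ^ e)) p^[1+e]∣xb)
  ... | inj₂ p∣b = ⊥-elim (p∤b p∣b)
  ... | inj₁ (divides q refl) =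
    subst (_∣ q * p) (*-comm (p ^ e) p) (*-monoˡ-∣ p (p^e∣x*b⇒p^e∣x e q p∤b (*-cancelˡ-∣ p p*p^e∣p*qb)))
    where
    p*p^e∣p*qb : p * p ^ e ∣ p * (q * b)
    p*p^e∣p*qb = subst (p * p ^ e ∣_) (solve 3 (λ q p b → q :* p :* b := p :* (q :* b)) refl q p b) p^[1+e]∣xb

  -- From (j+1) binom(p^e, j+1) = p^e binom(p^e - 1, j): if p ∤ binom(p^e, j+1) then p^e ∣ j+1.
  p∣binom[p^e,j] : ∀ e j → 0 < j → j < p ^ e → p ∣ binom (p ^ e) j
  p∣binom[p^e,j] e (suc j) _ j<p^e with p ∣? binom (p ^ e) (suc j)
  ... | yes p∣binom = p∣binom
  ... | no  p∤binom = ⊥-elim (<⇒≱ j<p^e (∣⇒≤ (p^e∣x*b⇒p^e∣x e (suc j) p∤binom p^e∣[1+j]*binom)))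
    where
    instance _ = m^n≢0 p e
    p^e∣[1+j]*binom : p ^ e ∣ suc j * binom (p ^ e) (suc j)
    p^e∣[1+j]*binom = subst (λ Q → Q ∣ suc j * binom Q (suc j)) (suc-pred (p ^ e))
      (subst (suc (pred (p ^ e)) ∣_) (sym (binom-absorption (pred (p ^ e)) j)) (m∣m*n _))

  module _ (e : ℕ) where

    private instance
      p^e≢0 : NonZero (p ^ e)
      p^e≢0 = m^n≢0 p e

    affine-cancel-mod : ∀ a {b} t t′ → ¬ p ∣ b →
      (a + t * b) % p ^ e ≡ (a + t′ * b) % p ^ e → t % p ^ e ≡ t′ % p ^ e
    affine-cancel-mod a {b} t t′ p∤b eq =
      ⊎-elim (λ t≤t′ → ordered t≤t′ eq) (λ t′≤t → sym (ordered t′≤t (sym eq))) (≤-total t t′)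
      where
      ordered : ∀ {t t′} → t ≤ t′ →
        (a + t * b) % p ^ e ≡ (a + t′ * b) % p ^ e → t % p ^ e ≡ t′ % p ^ e
      ordered {t} t≤t′ eq with m≤n⇒∃[o]m+o≡n t≤t′
      ... | d , refl = sym (%-remove-+ʳ t (p^e∣x*b⇒p^e∣x e d p∤b
        (+-≡-mod⇒∣ (p ^ e) (a + t * b) (d * b) (trans (cong (_% p ^ e) (regroup a t d)) (sym eq)))))
        where
        regroup : ∀ a t d → a + t * b + d * b ≡ a + (t + d) * b
        regroup a t d = solve 4 (λ a t d b → a :+ t :* b :+ d :* b := a :+ (t :+ d) :* b) refl a t d b

-- By Vandermonde, binom (x + Q) j = Σᵢ binom Q i · binom x (j ∸ i); modulo p only i = 0 and i = Q survive.
module BinomialShift (p : ℕ) .{{_ : NonZero p}} (Q : ℕ) .{{_ : NonZero Q}}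
  (p∣binom[Q,j] : ∀ j → 0 < j → j < Q → p ∣ binom Q j) where

  open Congruence p

  binom-periodic : ∀ x j → j < Q → binom (x + Q) j ≈ binom x j
  binom-periodic zero    zero    _   = refl
  binom-periodic zero    (suc j) j<Q = ∣⇒≈0 (p∣binom[Q,j] (suc j) z<s j<Q)
  binom-periodic (suc x) zero    _   = refl
  binom-periodic (suc x) (suc j) j<Q =
    +-cong (binom-periodic x j (<-trans (n<1+n j) j<Q)) (binom-periodic x (suc j) j<Q)

  binom-periodic* : ∀ x q j → j < Q → binom (x + Q * q) j ≈ binom x j
  binom-periodic* x zero    j j<Q = ≡⇒≈ (cong (λ y → binom y j) (x+m*0≡x x Q))
  binom-periodic* x (suc q) j j<Q = begin
    binom (x + Q * suc q) j   ≡⟨ cong (λ y → binom y j) (x+m*[1+q]≡x+m*q+m x Q q) ⟩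
    binom (x + Q * q + Q) j   ≈⟨ binom-periodic (x + Q * q) j j<Q ⟩
    binom (x + Q * q) j       ≈⟨ binom-periodic* x q j j<Q ⟩
    binom x j                 ∎
    where open ≈-Reasoning

  binom-% : ∀ x j → j < Q → binom (x % Q) j ≈ binom x j
  binom-% x j j<Q = ≈-trans (≈-sym (binom-periodic* (x % Q) (x / Q) j j<Q))
    (≡⇒≈ (cong (λ y → binom y j) (trans (cong (x % Q +_) (*-comm Q (x / Q))) (sym (m≡m%n+[m/n]*n x Q)))))

  binom-carry₀ : ∀ x → binom (x + Q) Q ≈ binom x Q + 1
  binom-carry₀ zero = ≡⇒≈ (trans (binom[n,n]≡1 Q) (cong (_+ 1) (sym (n<k⇒binom≡0 (>-nonZero⁻¹ Q)))))
  binom-carry₀ (suc x) = begin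
    binom (suc x + Q) Q                            ≡⟨ binom-suc (x + Q) Q ⟩
    binom (x + Q) (pred Q) + binom (x + Q) Q
      ≈⟨ +-cong (binom-periodic x (pred Q) pred[Q]<Q) (binom-carry₀ x) ⟩
    binom x (pred Q) + (binom x Q + 1)             ≡⟨ +-assoc (binom x (pred Q)) (binom x Q) 1 ⟨
    binom x (pred Q) + binom x Q + 1               ≡⟨ cong (_+ 1) (binom-suc x Q) ⟨
    binom (suc x) Q + 1                            ∎
    where
    open ≈-Reasoning
    pred[Q]<Q : pred Q < Q
    pred[Q]<Q = subst (pred Q <_) (suc-pred Q) ≤-refl

  binom-carry : ∀ x j → binom (x + Q) (Q + j) ≈ binom x (Q + j) + binom x j
  binom-carry x zero =
    subst (λ k → binom (x + Q) k ≈ binom x k + 1) (sym (+-identityʳ Q)) (binom-carry₀ x)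
  binom-carry zero (suc j) = ≡⇒≈ (trans (n<k⇒binom≡0 (m<m+n Q z<s))
    (sym (trans (+-identityʳ _) (n<k⇒binom≡0 (≤-trans z<s (m≤n+m (suc j) Q))))))
  binom-carry (suc x) (suc j) = begin
    binom (suc x + Q) (Q + suc j)
      ≡⟨ binom-pascal-+suc (x + Q) Q j ⟩
    binom (x + Q) (Q + j) + binom (x + Q) (Q + suc j)
      ≈⟨ +-cong (binom-carry x j) (binom-carry x (suc j)) ⟩
    (binom x (Q + j) + binom x j) + (binom x (Q + suc j) + binom x (suc j))
      ≡⟨ interchange (binom x (Q + j)) (binom x j) (binom x (Q + suc j)) (binom x (suc j)) ⟩
    (binom x (Q + j) + binom x (Q + suc j)) + (binom x j + binom x (suc j))
      ≡⟨ cong (_+ binom (suc x) (suc j)) (binom-pascal-+suc x Q j) ⟨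
    binom (suc x) (Q + suc j) + binom (suc x) (suc j)
      ∎
    where open ≈-Reasoning

  binom-carry* : ∀ b x j → binom (x + Q * b) (Q + j) ≈ binom x (Q + j) + ∑[ u < b ] binom (x + Q * u) j
  binom-carry* zero x j = ≡⇒≈ (trans (cong (λ y → binom y (Q + j)) (x+m*0≡x x Q)) (sym (+-identityʳ _)))
  binom-carry* (suc b) x j = begin
    binom (x + Q * suc b) (Q + j)
      ≡⟨ cong (λ y → binom y (Q + j)) (x+m*[1+q]≡x+m*q+m x Q b) ⟩
    binom (x + Q * b + Q) (Q + j)
      ≈⟨ binom-carry (x + Q * b) j ⟩
    binom (x + Q * b) (Q + j) + binom (x + Q * b) j
      ≈⟨ +-cong (binom-carry* b x j) ≈-refl ⟩
    binom x (Q + j) + ∑[ u < b ] binom (x + Q * u) j + binom (x + Q * b) j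
      ≡⟨ +-assoc (binom x (Q + j)) _ _ ⟩
    binom x (Q + j) + ∑[ u < suc b ] binom (x + Q * u) j
      ∎
    where open ≈-Reasoning

module FiniteDifferences (m : ℕ) .{{_ : NonZero m}} where

  open Congruence m

  -- f has degree < D modulo m. Differences are witnessed rather than computed, since ℕ-subtraction truncates.
  DegreeBelow : ℕ → (ℕ → ℕ) → Set
  DegreeBelow zero    f = ∀ s → f s ≈ 0
  DegreeBelow (suc D) f = Σ (ℕ → ℕ) λ Δf → DegreeBelow D Δf × (∀ s → f (suc s) ≈ f s + Δf s)

  DegreeBelow-cong : ∀ D {f g} → (∀ s → f s ≈ g s) → DegreeBelow D f → DegreeBelow D g
  DegreeBelow-cong zero    f≈g f≈0 s = ≈-trans (≈-sym (f≈g s)) (f≈0 s)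
  DegreeBelow-cong (suc D) f≈g (Δf , degΔf , step) =
    Δf , degΔf , λ s → ≈-trans (≈-sym (f≈g (suc s))) (≈-trans (step s) (+-cong (f≈g s) ≈-refl))

  DegreeBelow-≈0 : ∀ D {f} → (∀ s → f s ≈ 0) → DegreeBelow D f
  DegreeBelow-≈0 zero    f≈0 = f≈0
  DegreeBelow-≈0 (suc D) f≈0 =
    (λ _ → 0) , DegreeBelow-≈0 D (λ _ → refl) ,
    λ s → ≈-trans (f≈0 (suc s)) (≈-sym (+-cong (f≈0 s) ≈-refl))

  DegreeBelow-const : ∀ c → DegreeBelow 1 (λ _ → c)
  DegreeBelow-const c = (λ _ → 0) , (λ _ → refl) , λ _ → ≡⇒≈ (sym (+-identityʳ c))

  DegreeBelow-shift : ∀ D {f} → DegreeBelow D f → DegreeBelow D (λ s → f (suc s))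
  DegreeBelow-shift zero    f≈0                  s = f≈0 (suc s)
  DegreeBelow-shift (suc D) (Δf , degΔf , step) =
    (λ s → Δf (suc s)) , DegreeBelow-shift D degΔf , λ s → step (suc s)

  DegreeBelow-+ : ∀ D {f g} → DegreeBelow D f → DegreeBelow D g → DegreeBelow D (λ s → f s + g s)
  DegreeBelow-+ zero    f≈0 g≈0 s = +-cong (f≈0 s) (g≈0 s)
  DegreeBelow-+ (suc D) {f} {g} (Δf , degΔf , stepf) (Δg , degΔg , stepg) =
    (λ s → Δf s + Δg s) , DegreeBelow-+ D degΔf degΔg ,
    λ s → ≈-trans (+-cong (stepf s) (stepg s)) (≡⇒≈ (interchange (f s) (Δf s) (g s) (Δg s)))

  DegreeBelow-sum : ∀ D b (F : ℕ → ℕ → ℕ) → (∀ u → DegreeBelow D (F u)) →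
    DegreeBelow D (λ s → ∑[ u < b ] F u s)
  DegreeBelow-sum D zero    F degF = DegreeBelow-≈0 D (λ _ → refl)
  DegreeBelow-sum D (suc b) F degF = DegreeBelow-+ D (DegreeBelow-sum D b F degF) (degF b)

  -- Leibniz rule: Δ(f g)(s) = Δf(s) g(s+1) + f(s) Δg(s).
  DegreeBelow-* : ∀ D₁ D₂ {f g} → DegreeBelow D₁ f → DegreeBelow (suc D₂) g →
    DegreeBelow (D₁ + D₂) (λ s → f s * g s)
  DegreeBelow-* zero D₂ {f} {g} f≈0 _ = DegreeBelow-≈0 D₂ (λ s → *-cong (f≈0 s) (≈-refl {g s}))
  DegreeBelow-* (suc D₁) D₂ {f} {g} degf@(Δf , degΔf , stepf) degg@(Δg , degΔg , stepg) =
    (λ s → Δf s * g (suc s) + f s * Δg s) ,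
    DegreeBelow-+ (D₁ + D₂) (DegreeBelow-* D₁ D₂ degΔf (DegreeBelow-shift (suc D₂) degg)) f*Δg-degree ,
    step
    where
    f*Δg-degree : DegreeBelow (D₁ + D₂) (λ s → f s * Δg s)
    f*Δg-degree = subst (λ D → DegreeBelow D (λ s → f s * Δg s)) (+-comm D₂ D₁)
      (DegreeBelow-cong (D₂ + D₁) (λ s → ≡⇒≈ (*-comm (Δg s) (f s))) (DegreeBelow-* D₂ D₁ degΔg degf))
    step : ∀ s → f (suc s) * g (suc s) ≈ f s * g s + (Δf s * g (suc s) + f s * Δg s)
    step s = begin
      f (suc s) * g (suc s)                          ≈⟨ *-cong (stepf s) ≈-refl ⟩
      (f s + Δf s) * g (suc s)                       ≡⟨ *-distribʳ-+ (g (suc s)) (f s) (Δf s) ⟩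
      f s * g (suc s) + Δf s * g (suc s)             ≈⟨ +-cong (*-cong (≈-refl {f s}) (stepg s)) ≈-refl ⟩
      f s * (g s + Δg s) + Δf s * g (suc s)
        ≡⟨ solve 5 (λ a b c d e → a :* (b :+ c) :+ d :* e := a :* b :+ (d :* e :+ a :* c))
                 refl (f s) (g s) (Δg s) (Δf s) (g (suc s)) ⟩
      f s * g s + (Δf s * g (suc s) + f s * Δg s)    ∎
      where open ≈-Reasoning

  telescope : ∀ {f Δf : ℕ → ℕ} → (∀ s → f (suc s) ≈ f s + Δf s) → ∀ s → f s ≈ f 0 + sumBelow s Δf
  telescope {f}      step zero    = ≡⇒≈ (sym (+-identityʳ (f 0)))
  telescope {f} {Δf} step (suc s) = ≈-trans (step s) (≈-trans
    (+-cong (telescope {f} {Δf} step s) (≈-refl {Δf s})) (≡⇒≈ (+-assoc (f 0) (sumBelow s Δf) (Δf s))))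

  sum-newton : ∀ D {f} → DegreeBelow D f →
    ∃ λ (c : ℕ → ℕ) → ∀ N → sumBelow N f ≈ ∑[ i < D ] (c i * binom N (suc i))
  sum-newton zero f≈0 = (λ _ → 0) , λ N →
    ≈-trans (sumBelow-cong≈ N (λ s _ → f≈0 s)) (≡⇒≈ (sumBelow-zero N))
  sum-newton (suc D) {f} (Δf , degΔf , step) with sum-newton D degΔf
  ... | c′ , ΣΔf≈ = c , Σf≈
    where
    c : ℕ → ℕ
    c zero    = f 0
    c (suc i) = c′ i
    Σf≈ : ∀ N → sumBelow N f ≈ ∑[ i < suc D ] (c i * binom N (suc i))
    Σf≈ N = begin
      sumBelow N f
        ≈⟨ sumBelow-cong≈ N (λ s _ → telescope {f} {Δf} step s) ⟩
      ∑[ s < N ] (f 0 + sumBelow s Δf)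
        ≡⟨ sumBelow-+ N (λ _ → f 0) (λ s → sumBelow s Δf) ⟩
      ∑[ s < N ] f 0 + ∑[ s < N ] sumBelow s Δf
        ≈⟨ +-cong ≈-refl (sumBelow-cong≈ N (λ s _ → ΣΔf≈ s)) ⟩
      ∑[ s < N ] f 0 + ∑[ s < N ] ∑[ i < D ] (c′ i * binom s (suc i))
        ≡⟨ cong₂ _+_ constant-part difference-part ⟩
      f 0 * binom N 1 + ∑[ i < D ] (c′ i * binom N (2 + i))
        ≡⟨ sumBelow-suc D (λ i → c i * binom N (suc i)) ⟨
      ∑[ i < suc D ] (c i * binom N (suc i))
        ∎
      where
      open ≈-Reasoning
      constant-part : ∑[ s < N ] f 0 ≡ f 0 * binom N 1
      constant-part = trans (sumBelow-const N (f 0)) (trans (*-comm N (f 0)) (cong (f 0 *_) (sym (binom[n,1]≡n N))))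
      difference-part : ∑[ s < N ] ∑[ i < D ] (c′ i * binom s (suc i)) ≡ ∑[ i < D ] (c′ i * binom N (2 + i))
      difference-part = trans (sumBelow-swap N D (λ s i → c′ i * binom s (suc i)))
        (sumBelow-cong D (λ i _ → trans (sumBelow-*ˡ N (c′ i) (λ s → binom s (suc i)))
                                         (cong (c′ i *_) (hockey-stick N (suc i)))))

module PrimeFiniteDifferences {p : ℕ} (p-prime : Prime p) where

  private instance
    p≢0 : NonZero p
    p≢0 = prime⇒nonZero p-prime

  open Congruence p
  open FiniteDifferences p
  open PrimePower p-prime

  sum-p^e-vanishes : ∀ e D {f} → DegreeBelow D f → D < p ^ e → ∑[ s < p ^ e ] f s ≈ 0
  sum-p^e-vanishes e D degf D<p^e with sum-newton D degf
  ... | c , Σf≈ = ≈-trans (Σf≈ (p ^ e)) (≈-trans (sumBelow-cong≈ D coefficient≈0)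
    (≡⇒≈ (trans (sumBelow-cong D (λ i _ → *-zeroʳ (c i))) (sumBelow-zero D))))
    where
    coefficient≈0 : ∀ i → i < D → c i * binom (p ^ e) (suc i) ≈ c i * 0
    coefficient≈0 i i<D = *-cong (≈-refl {c i}) (∣⇒≈0 (p∣binom[p^e,j] e (suc i) z<s (≤-<-trans i<D D<p^e)))

below-or-above : ∀ Q j → j < Q ⊎ ∃ λ j′ → Q + j′ ≡ j
below-or-above Q j with j <? Q
... | yes j<Q = inj₁ j<Q
... | no  j≮Q = inj₂ (m≤n⇒∃[o]m+o≡n (≮⇒≥ j≮Q))

[Q+j]/Q≡1+j/Q : ∀ Q .{{_ : NonZero Q}} j → (Q + j) / Q ≡ suc (j / Q)
[Q+j]/Q≡1+j/Q Q j = trans (m/n≡1+[m∸n]/n (m≤m+n Q j)) (cong (λ i → suc (i / Q)) (m+n∸m≡n Q j))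

module RaySums {p : ℕ} (p-prime : Prime p) (ℓ m : ℕ) where

  P M : ℕ
  P = p ^ ℓ
  M = p ^ m

  private instance
    p≢0 : NonZero p
    p≢0 = prime⇒nonZero p-prime
    P≢0 : NonZero P
    P≢0 = m^n≢0 p ℓ

  open Congruence p
  open FiniteDifferences p
  open PrimeFiniteDifferences p-prime
  open BinomialShift p P (PrimePower.p∣binom[p^e,j] p-prime ℓ)

  ray : ℕ → ℕ → ℕ → ℕ
  ray y b s = y + P * (s * b)

  ray-suc : ∀ y b s → ray y b (suc s) ≡ ray y b s + P * b
  ray-suc y b s = solve 4 (λ y b s P → y :+ P :* ((con 1 :+ s) :* b) := y :+ P :* (s :* b) :+ P :* b) refl y b s P

  ray-+ : ∀ y u b s → ray (y + P * u) b s ≡ ray y b s + P * u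
  ray-+ y u b s = solve 5 (λ y u b s P → y :+ P :* u :+ P :* (s :* b) := y :+ P :* (s :* b) :+ P :* u) refl y u b s P

  binom-ray-degree : ∀ j y b → DegreeBelow (suc (j / P)) (λ s → binom (ray y b s) j)
  binom-ray-degree j y b = go (suc (j / P)) j y b ≤-refl
    where
    go : ∀ D j y b → j / P < D → DegreeBelow D (λ s → binom (ray y b s) j)
    go (suc D) j y b j/P<1+D with below-or-above P j
    ... | inj₁ j<P = (λ _ → 0) , DegreeBelow-≈0 D (λ _ → refl) , λ s → begin
      binom (ray y b (suc s)) j      ≡⟨ cong (λ x → binom x j) (ray-suc y b s) ⟩
      binom (ray y b s + P * b) j    ≈⟨ binom-periodic* (ray y b s) b j j<P ⟩
      binom (ray y b s) j            ≡⟨ +-identityʳ _ ⟨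
      binom (ray y b s) j + 0        ∎
      where open ≈-Reasoning
    ... | inj₂ (j′ , refl) = (λ s → ∑[ u < b ] binom (ray y b s + P * u) j′) , Δ-degree , λ s → begin
      binom (ray y b (suc s)) (P + j′)    ≡⟨ cong (λ x → binom x (P + j′)) (ray-suc y b s) ⟩
      binom (ray y b s + P * b) (P + j′)  ≈⟨ binom-carry* b (ray y b s) j′ ⟩
      binom (ray y b s) (P + j′) + ∑[ u < b ] binom (ray y b s + P * u) j′ ∎
      where
      open ≈-Reasoning
      j′/P<D : j′ / P < D
      j′/P<D = s<s⁻¹ (subst (_< suc D) ([Q+j]/Q≡1+j/Q P j′) j/P<1+D)
      Δ-degree : DegreeBelow D (λ s → ∑[ u < b ] binom (ray y b s + P * u) j′)
      Δ-degree = DegreeBelow-cong D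
        (λ s → ≡⇒≈ (sumBelow-cong b (λ u _ → cong (λ x → binom x j′) (ray-+ y u b s))))
        (DegreeBelow-sum D b (λ u s → binom (ray (y + P * u) b s) j′) (λ u → go D j′ (y + P * u) b j′/P<D))

  φ-ray : ∀ {n} → Vec ℕ n → Vec ℕ n → Vec ℕ n → ℕ → ℕ
  φ-ray []       []       []       s = 1
  φ-ray (α ∷ αs) (y ∷ ys) (b ∷ bs) s = binom (ray y b s) α * φ-ray αs ys bs s

  highPart : ∀ {n} → Vec ℕ n → ℕ
  highPart []       = 0
  highPart (α ∷ αs) = α / P + highPart αs

  φ-ray-degree : ∀ {n} (α y b : Vec ℕ n) → DegreeBelow (suc (highPart α)) (φ-ray α y b)
  φ-ray-degree []       []       []       = DegreeBelow-const 1
  φ-ray-degree (α ∷ αs) (y ∷ ys) (b ∷ bs) =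
    DegreeBelow-* (suc (α / P)) (highPart αs) (binom-ray-degree α y b) (φ-ray-degree αs ys bs)

  -- The correction term binom(x, j - P) from binom-carry has lower degree, so its weighted sum vanishes.
  weighted-sum-shift₁ : ∀ E {w} j y b → DegreeBelow (suc E) w → E + j / P < M →
    ∑[ s < M ] (w s * binom (ray y b s + P) j) ≈ ∑[ s < M ] (w s * binom (ray y b s) j)
  weighted-sum-shift₁ E {w} j y b degw E+j/P<M with below-or-above P j
  ... | inj₁ j<P = sumBelow-cong≈ M (λ s _ → *-cong (≈-refl {w s}) (binom-periodic (ray y b s) j j<P))
  ... | inj₂ (j′ , refl) = begin
    ∑[ s < M ] (w s * binom (ray y b s + P) (P + j′))
      ≈⟨ sumBelow-cong≈ M (λ s _ → *-cong (≈-refl {w s}) (binom-carry (ray y b s) j′)) ⟩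
    ∑[ s < M ] (w s * (binom (ray y b s) (P + j′) + binom (ray y b s) j′))
      ≡⟨ trans (sumBelow-cong M (λ s _ → *-distribˡ-+ (w s) _ _)) (sumBelow-+ M _ _) ⟩
    ∑[ s < M ] (w s * binom (ray y b s) (P + j′)) + ∑[ s < M ] (w s * binom (ray y b s) j′)
      ≈⟨ +-cong ≈-refl (sum-p^e-vanishes m (suc E + j′ / P) lower-degree lower-degree<M) ⟩
    ∑[ s < M ] (w s * binom (ray y b s) (P + j′)) + 0
      ≡⟨ +-identityʳ _ ⟩
    ∑[ s < M ] (w s * binom (ray y b s) (P + j′))
      ∎
    where
    open ≈-Reasoning
    lower-degree : DegreeBelow (suc E + j′ / P) (λ s → w s * binom (ray y b s) j′)
    lower-degree = DegreeBelow-* (suc E) (j′ / P) degw (binom-ray-degree j′ y b)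
    lower-degree<M : suc E + j′ / P < M
    lower-degree<M = subst (_< M) (trans (cong (E +_) ([Q+j]/Q≡1+j/Q P j′)) (+-suc E (j′ / P))) E+j/P<M

  weighted-sum-shift : ∀ E {w} j y d b → DegreeBelow (suc E) w → E + j / P < M →
    ∑[ s < M ] (w s * binom (ray (y + P * d) b s) j) ≈ ∑[ s < M ] (w s * binom (ray y b s) j)
  weighted-sum-shift E {w} j y zero b degw bound =
    ≡⇒≈ (sumBelow-cong M (λ s _ → cong (λ x → w s * binom (ray x b s) j) (x+m*0≡x y P)))
  weighted-sum-shift E {w} j y (suc d) b degw bound = begin
    ∑[ s < M ] (w s * binom (ray (y + P * suc d) b s) j)
      ≡⟨ sumBelow-cong M (λ s _ → cong (λ x → w s * binom x j) (ray-+1 s)) ⟩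
    ∑[ s < M ] (w s * binom (ray (y + P * d) b s + P) j)
      ≈⟨ weighted-sum-shift₁ E j (y + P * d) b degw bound ⟩
    ∑[ s < M ] (w s * binom (ray (y + P * d) b s) j)
      ≈⟨ weighted-sum-shift E j y d b degw bound ⟩
    ∑[ s < M ] (w s * binom (ray y b s) j)
      ∎
    where
    open ≈-Reasoning
    ray-+1 : ∀ s → ray (y + P * suc d) b s ≡ ray (y + P * d) b s + P
    ray-+1 s = solve 5 (λ y d b s P → y :+ P :* (con 1 :+ d) :+ P :* (s :* b) := y :+ P :* d :+ P :* (s :* b) :+ P)
      refl y d b s P

  infixl 6 _+ᴾ_
  _+ᴾ_ : ∀ {n} → Vec ℕ n → Vec ℕ n → Vec ℕ n
  _+ᴾ_ = Vec.zipWith (λ y d → y + P * d)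

  weighted-φ-ray-shift : ∀ {n} (α y d b : Vec ℕ n) E {w} → DegreeBelow (suc E) w → E + highPart α < M →
    ∑[ s < M ] (w s * φ-ray α (y +ᴾ d) b s) ≈ ∑[ s < M ] (w s * φ-ray α y b s)
  weighted-φ-ray-shift []       []       []       []       E degw bound = ≈-refl
  weighted-φ-ray-shift (α ∷ αs) (y ∷ ys) (d ∷ ds) (b ∷ bs) E {w} degw bound = begin
    ∑[ s < M ] (w s * (binom (ray (y + P * d) b s) α * φ-ray αs (ys +ᴾ ds) bs s))
      ≡⟨ sumBelow-cong M (λ s _ → sym (*-assoc (w s) _ _)) ⟩
    ∑[ s < M ] (w s * binom (ray (y + P * d) b s) α * φ-ray αs (ys +ᴾ ds) bs s)
      ≈⟨ weighted-φ-ray-shift αs ys ds bs (E + α / P) head-weight-degree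
           (subst (_< M) (sym (+-assoc E (α / P) (highPart αs))) bound) ⟩
    ∑[ s < M ] (w s * binom (ray (y + P * d) b s) α * φ-ray αs ys bs s)
      ≡⟨ sumBelow-cong M (λ s _ → xy∙z≈xz∙y (w s) _ _) ⟩
    ∑[ s < M ] (w s * φ-ray αs ys bs s * binom (ray (y + P * d) b s) α)
      ≈⟨ weighted-sum-shift (E + highPart αs) α y d b tail-weight-degree
           (subst (_< M) (trans (cong (E +_) (+-comm (α / P) (highPart αs)))
                                (sym (+-assoc E (highPart αs) (α / P)))) bound) ⟩
    ∑[ s < M ] (w s * φ-ray αs ys bs s * binom (ray y b s) α)
      ≡⟨ sumBelow-cong M (λ s _ → trans (xy∙z≈xz∙y (w s) _ _) (*-assoc (w s) _ _)) ⟩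
    ∑[ s < M ] (w s * (binom (ray y b s) α * φ-ray αs ys bs s))
      ∎
    where
    open ≈-Reasoning
    head-weight-degree : DegreeBelow (suc (E + α / P)) (λ s → w s * binom (ray (y + P * d) b s) α)
    head-weight-degree = DegreeBelow-* (suc E) (α / P) degw (binom-ray-degree α (y + P * d) b)
    tail-weight-degree : DegreeBelow (suc (E + highPart αs)) (λ s → w s * φ-ray αs ys bs s)
    tail-weight-degree = DegreeBelow-* (suc E) (highPart αs) degw (φ-ray-degree αs ys bs)

  raySum : ∀ {n} → Vec ℕ n → Vec ℕ n → Vec ℕ n → ℕ
  raySum α y b = ∑[ s < M ] φ-ray α y b s

  raySum-shift : ∀ {n} (α y d b : Vec ℕ n) → highPart α < M → raySum α (y +ᴾ d) b ≈ raySum α y b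
  raySum-shift α y d b bound = begin
    raySum α (y +ᴾ d) b                     ≡⟨ sumBelow-cong M (λ s _ → sym (*-identityˡ _)) ⟩
    ∑[ s < M ] (1 * φ-ray α (y +ᴾ d) b s)   ≈⟨ weighted-φ-ray-shift α y d b 0 (DegreeBelow-const 1) bound ⟩
    ∑[ s < M ] (1 * φ-ray α y b s)          ≡⟨ sumBelow-cong M (λ s _ → *-identityˡ _) ⟩
    raySum α y b                            ∎
    where open ≈-Reasoning

  infix 4 _≋_
  _≋_ : ∀ {n} → Vec ℕ n → Vec ℕ n → Set
  _≋_ = Pointwise (_≡_ on (_% P))

  ≋-sym : ∀ {n} {x y : Vec ℕ n} → x ≋ y → y ≋ x
  ≋-sym = Pointwise.sym sym

  ≋-trans : ∀ {n} {x y z : Vec ℕ n} → x ≋ y → y ≋ z → x ≋ z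
  ≋-trans = Pointwise.trans trans

  -- y + P ⌊y′/P⌋ = y′ + P ⌊y/P⌋ when y ≡ y′ (mod P), so each side is a shift of the other.
  +ᴾ-swap : ∀ {n} {y y′ : Vec ℕ n} → y ≋ y′ →
    y +ᴾ Vec.map (_/ P) y′ ≡ y′ +ᴾ Vec.map (_/ P) y
  +ᴾ-swap [] = refl
  +ᴾ-swap {y = y ∷ _} {y′ ∷ _} (y≡y′ ∷ ys≡ys′) = cong₂ _∷_ swap (+ᴾ-swap ys≡ys′)
    where
    open ≡-Reasoning
    swap : y + P * (y′ / P) ≡ y′ + P * (y / P)
    swap = begin
      y + P * (y′ / P)                         ≡⟨ cong (_+ P * (y′ / P)) (m≡m%n+[m/n]*n y P) ⟩
      y % P + y / P * P + P * (y′ / P)         ≡⟨ cong (λ r → r + y / P * P + P * (y′ / P)) y≡y′ ⟩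
      y′ % P + y / P * P + P * (y′ / P)
        ≡⟨ solve 4 (λ r a b P → r :+ a :* P :+ P :* b := r :+ b :* P :+ P :* a) refl (y′ % P) (y / P) (y′ / P) P ⟩
      y′ % P + y′ / P * P + P * (y / P)        ≡⟨ cong (_+ P * (y / P)) (m≡m%n+[m/n]*n y′ P) ⟨
      y′ + P * (y / P)                         ∎

  raySum-cong : ∀ {n} (α b : Vec ℕ n) {y y′} → highPart α < M → y ≋ y′ →
    raySum α y b ≈ raySum α y′ b
  raySum-cong α b {y} {y′} bound y≡y′ = begin
    raySum α y b                                ≈⟨ raySum-shift α y (Vec.map (_/ P) y′) b bound ⟨
    raySum α (y +ᴾ Vec.map (_/ P) y′) b         ≡⟨ cong (λ z → raySum α z b) (+ᴾ-swap y≡y′) ⟩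
    raySum α (y′ +ᴾ Vec.map (_/ P) y) b         ≈⟨ raySum-shift α y′ (Vec.map (_/ P) y) b bound ⟩
    raySum α y′ b                               ∎
    where open ≈-Reasoning

allVecs≡cartesianProduct : ∀ m n → allVecs m (suc n) ≡ cartesianProductWith _∷_ (upTo m) (allVecs m n)
allVecs≡cartesianProduct m n = go (upTo m)
  where
  go : ∀ is → List.concatMap (λ i → List.map (i ∷_) (allVecs m n)) is ≡
              cartesianProductWith _∷_ is (allVecs m n)
  go []       = refl
  go (i ∷ is) = cong (List.map (i ∷_) (allVecs m n) List.++_) (go is)

∈-allVecs⁺ : ∀ m {n} {x : Vec ℕ n} → VAll.All (_< m) x → x ∈ allVecs m n
∈-allVecs⁺ m VAll.[]               = LAny.here refl
∈-allVecs⁺ m {suc n} (xᵢ<m VAll.∷ xs<m) = subst (_ ∈_) (sym (allVecs≡cartesianProduct m n))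
  (∈-cartesianProductWith⁺ _∷_ (∈-upTo⁺ xᵢ<m) (∈-allVecs⁺ m xs<m))

allVecs-unique : ∀ m n → Unique (allVecs m n)
allVecs-unique m zero    = LAll.[] AllPairs.∷ AllPairs.[]
allVecs-unique m (suc n) = subst Unique (sym (allVecs≡cartesianProduct m n))
  (Unique.cartesianProductWith⁺ _∷_ ∷-injective (Unique.upTo⁺ m) (allVecs-unique m n))

sum-applyUpTo : ∀ g n → sum (List.applyUpTo g n) ≡ ∑[ i < n ] g i
sum-applyUpTo g zero    = refl
sum-applyUpTo g (suc n) = begin
  sum (List.applyUpTo g (suc n))             ≡⟨ cong sum (applyUpTo-∷ʳ g n) ⟨
  sum (List.applyUpTo g n List.++ g n ∷ [])  ≡⟨ sum-++ (List.applyUpTo g n) (g n ∷ []) ⟩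
  sum (List.applyUpTo g n) + (g n + 0)       ≡⟨ cong₂ _+_ (sum-applyUpTo g n) (+-identityʳ (g n)) ⟩
  ∑[ i < suc n ] g i                         ∎
  where open ≡-Reasoning

sum-map-sameElements : ∀ {A : Set} (f : A → ℕ) {xs ys} → Unique xs → Unique ys →
  (∀ {x} → x ∈ xs ⇔ x ∈ ys) → sum (List.map f xs) ≡ sum (List.map f ys)
sum-map-sameElements f xs! ys! xs⇔ys = sum-↭ (↭-map⁺ f (∼bag⇒↭ (unique∧set⇒bag xs! ys! xs⇔ys)))

r+Q*s<Q*M : ∀ {Q M r s} → r < Q → s < M → r + Q * s < Q * M
r+Q*s<Q*M {Q} {M} {r} {s} r<Q s<M = begin-strict
  r + Q * s   <⟨ +-monoˡ-< (Q * s) r<Q ⟩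
  Q + Q * s   ≡⟨ *-suc Q s ⟨
  Q * suc s   ≤⟨ *-monoʳ-≤ Q s<M ⟩
  Q * M       ∎
  where open ≤-Reasoning

module LinesInCubes {p : ℕ} (p-prime : Prime p) {k ℓ : ℕ} (ℓ≤k : ℓ ≤ k) where

  open RaySums p-prime ℓ (k ∸ ℓ) public

  private instance
    p≢0 : NonZero p
    p≢0 = prime⇒nonZero p-prime
    p^ℓ≢0 : NonZero P
    p^ℓ≢0 = m^n≢0 p ℓ
    p^k≢0 : NonZero (p ^ k)
    p^k≢0 = m^n≢0 p k

  p^k≡P*M : p ^ k ≡ P * M
  p^k≡P*M = trans (cong (p ^_) (sym (m+[n∸m]≡n ℓ≤k))) (^-distribˡ-+-* p ℓ (k ∸ ℓ))

  %p^k%P : ∀ x → x % p ^ k % P ≡ x % P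
  %p^k%P x = m∣n⇒o%n%m≡o%m P (p ^ k) x (divides M (trans p^k≡P*M (*-comm P M)))

  inCube⁻ : ∀ {n} (c y : Vec ℕ n) → T (inCube p ℓ c y) → c ≋ y
  inCube⁻ []       []       _       = []
  inCube⁻ (c ∷ cs) (y ∷ ys) y∈cube with Equivalence.to T-∧ y∈cube
  ... | cᵢ≡yᵢ , ys∈cube = toWitness cᵢ≡yᵢ ∷ inCube⁻ cs ys ys∈cube

  inCube⁺ : ∀ {n} (c y : Vec ℕ n) → c ≋ y → T (inCube p ℓ c y)
  inCube⁺ []       []       _                = _
  inCube⁺ (c ∷ cs) (y ∷ ys) (cᵢ≡yᵢ ∷ cs≋ys) =
    Equivalence.from T-∧ (fromWitness cᵢ≡yᵢ , inCube⁺ cs ys cs≋ys)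

  module _ {n} (a b : Vec ℕ n) where

    pt : ℕ → Vec ℕ n
    pt = linePt p k a b

    affine : ℕ → Vec ℕ n
    affine t = Vec.zipWith (λ aᵢ bᵢ → aᵢ + t * bᵢ) a b

    onLine⁻ : ∀ {x} → T (onLine p k a b x) → ∃ λ t → t < p ^ k × x ≡ pt t
    onLine⁻ {x} x∈L with find (any⁻ _ (upTo (p ^ k)) x∈L)
    ... | t , t∈upTo , x≡pt = t , ∈-upTo⁻ t∈upTo , toWitness x≡pt

    onLine⁺ : ∀ {t} → t < p ^ k → T (onLine p k a b (pt t))
    onLine⁺ t<p^k = any⁺ _ (lose (∈-upTo⁺ t<p^k) (fromWitness refl))

    pt-IsPoint : ∀ t → IsPoint p k n (pt t)
    pt-IsPoint t = go a b
      where
      go : ∀ {n} (a b : Vec ℕ n) → IsPoint p k n (linePt p k a b t)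
      go []       []       = VAll.[]
      go (a ∷ as) (b ∷ bs) = m%n<n (a + t * b) (p ^ k) VAll.∷ go as bs

  pt≋affine : ∀ {n} (a b : Vec ℕ n) t → pt a b t ≋ affine a b t
  pt≋affine []       []       t = []
  pt≋affine (a ∷ as) (b ∷ bs) t = %p^k%P (a + t * b) ∷ pt≋affine as bs t

  affine-cong : ∀ {n} (a b : Vec ℕ n) {t t′} → t % P ≡ t′ % P → affine a b t ≋ affine a b t′
  affine-cong []       []       t≡t′ = []
  affine-cong (a ∷ as) (b ∷ bs) t≡t′ = +-cong ≈-refl (*-cong t≡t′ ≈-refl) ∷ affine-cong as bs t≡t′
    where open Congruence P

  pt-cong : ∀ {n} (a b : Vec ℕ n) {t t′} → t % P ≡ t′ % P → pt a b t ≋ pt a b t′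
  pt-cong a b {t} {t′} t≡t′ =
    ≋-trans (pt≋affine a b t) (≋-trans (affine-cong a b t≡t′) (≋-sym (pt≋affine a b t′)))

  pt-cancel : ∀ {n} (a b : Vec ℕ n) → HasUnitCoord p n b →
    ∀ {t t′} → pt a b t ≋ pt a b t′ → t % P ≡ t′ % P
  pt-cancel (a ∷ _) (b ∷ _) (VAny.here p∤b) {t} {t′} (pt≡pt′ ∷ _) =
    PrimePower.affine-cancel-mod p-prime ℓ a t t′ p∤b
      (trans (sym (%p^k%P (a + t * b))) (trans pt≡pt′ (%p^k%P (a + t′ * b))))
  pt-cancel (_ ∷ as) (_ ∷ bs) (VAny.there unit) (_ ∷ pts≋pts′) = pt-cancel as bs unit pts≋pts′

  pt-injective : ∀ {n} (a b : Vec ℕ n) → HasUnitCoord p n b → ∀ {t t′} → t < p ^ k → t′ < p ^ k →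
    pt a b t ≡ pt a b t′ → t ≡ t′
  pt-injective (a ∷ _) (b ∷ _) (VAny.here p∤b) {t} {t′} t<p^k t′<p^k pt≡pt′ =
    trans (sym (m<n⇒m%n≡m t<p^k))
      (trans (PrimePower.affine-cancel-mod p-prime k a t t′ p∤b (proj₁ (∷-injective pt≡pt′)))
        (m<n⇒m%n≡m t′<p^k))
  pt-injective (_ ∷ as) (_ ∷ bs) (VAny.there unit) t<p^k t′<p^k pt≡pt′ =
    pt-injective as bs unit t<p^k t′<p^k (proj₂ (∷-injective pt≡pt′))

  module LineThroughCube {n} (a b c : Vec ℕ n) (unit : HasUnitCoord p n b) {t₀} (t₀∈cube : c ≋ pt a b t₀) where

    r : ℕ
    r = t₀ % P

    cubePt : ℕ → Vec ℕ n
    cubePt s = pt a b (r + P * s)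

    r+P*s≡t₀ : ∀ s → (r + P * s) % P ≡ t₀ % P
    r+P*s≡t₀ s = trans (cong (λ x → (r + x) % P) (*-comm P s)) (trans ([m+kn]%n≡m%n r s P) (m%n%n≡m%n t₀ P))

    r+P*s<p^k : ∀ {s} → s < M → r + P * s < p ^ k
    r+P*s<p^k s<M = subst (r + P * _ <_) (sym p^k≡P*M) (r+Q*s<Q*M (m%n<n t₀ P) s<M)

    cubePt-IsPoint : ∀ s → IsPoint p k n (cubePt s)
    cubePt-IsPoint s = pt-IsPoint a b (r + P * s)

    cubePt∈cube : ∀ s → c ≋ cubePt s
    cubePt∈cube s = ≋-trans t₀∈cube (pt-cong a b (sym (r+P*s≡t₀ s)))

    cubePt-injective : ∀ {s s′} → s < M → s′ < M → cubePt s ≡ cubePt s′ → s ≡ s′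
    cubePt-injective s<M s′<M eq =
      *-cancelˡ-≡ _ _ P (+-cancelˡ-≡ r _ _ (pt-injective a b unit (r+P*s<p^k s<M) (r+P*s<p^k s′<M) eq))

    line∩cube : Vec ℕ n → Bool
    line∩cube x = onLine p k a b x ∧ inCube p ℓ c x

    ∈-line∩cube⇔ : ∀ {x} → x ∈ filterᵇ line∩cube (allVecs (p ^ k) n) ⇔ x ∈ List.applyUpTo cubePt M
    ∈-line∩cube⇔ = mk⇔ to from
      where
      to : ∀ {x} → x ∈ filterᵇ line∩cube (allVecs (p ^ k) n) → x ∈ List.applyUpTo cubePt M
      to {x} x∈ with Equivalence.to T-∧ (proj₂ (∈-filter⁻ (T? ∘ line∩cube) {xs = allVecs (p ^ k) n} x∈))
      ... | x∈line , x∈cube with onLine⁻ a b {x} x∈line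
      ... | t , t<p^k , refl = subst (_∈ _) (cong (pt a b) (sym t≡r+P*[t/P])) (∈-applyUpTo⁺ cubePt t/P<M)
        where
        t≡t₀ : t % P ≡ t₀ % P
        t≡t₀ = pt-cancel a b unit (≋-trans (≋-sym (inCube⁻ c (pt a b t) x∈cube)) t₀∈cube)
        t≡r+P*[t/P] : t ≡ r + P * (t / P)
        t≡r+P*[t/P] = trans (m≡m%n+[m/n]*n t P) (cong₂ _+_ t≡t₀ (*-comm (t / P) P))
        t/P<M : t / P < M
        t/P<M = m<n*o⇒m/o<n (subst (t <_) (trans p^k≡P*M (*-comm P M)) t<p^k)
      from : ∀ {x} → x ∈ List.applyUpTo cubePt M → x ∈ filterᵇ line∩cube (allVecs (p ^ k) n)
      from {x} x∈ with ∈-applyUpTo⁻ cubePt x∈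
      ... | s , s<M , refl = ∈-filter⁺ (T? ∘ line∩cube) (∈-allVecs⁺ (p ^ k) (cubePt-IsPoint s))
        (Equivalence.from T-∧ (onLine⁺ a b {r + P * s} (r+P*s<p^k s<M) , inCube⁺ c (cubePt s) (cubePt∈cube s)))

    sumLineCube≡ : ∀ f → sumLineCube p k ℓ a b c f ≡ ∑[ s < M ] f (cubePt s)
    sumLineCube≡ f = begin
      sumLineCube p k ℓ a b c f
        ≡⟨ sum-map-sameElements f line∩cube-unique cubePts-unique ∈-line∩cube⇔ ⟩
      sum (List.map f (List.applyUpTo cubePt M))
        ≡⟨ cong sum (map-applyUpTo cubePt f M) ⟩
      sum (List.applyUpTo (f ∘ cubePt) M)
        ≡⟨ sum-applyUpTo (f ∘ cubePt) M ⟩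
      ∑[ s < M ] f (cubePt s)
        ∎
      where
      open ≡-Reasoning
      line∩cube-unique : Unique (filterᵇ line∩cube (allVecs (p ^ k) n))
      line∩cube-unique = Unique.filter⁺ (T? ∘ line∩cube) (allVecs-unique (p ^ k) n)
      cubePts-unique : Unique (List.applyUpTo cubePt M)
      cubePts-unique = Unique.applyUpTo⁺₁ cubePt M
        (λ i<j j<M eq → <⇒≢ i<j (cubePt-injective (<-trans i<j j<M) j<M eq))

    base∈cube : c ≋ affine a b r
    base∈cube = ≋-trans t₀∈cube (≋-trans (pt≋affine a b t₀) (affine-cong a b (sym (m%n%n≡m%n t₀ P))))

  open Congruence p
  open BinomialShift p (p ^ k) (PrimePower.p∣binom[p^e,j] p-prime k) using (binom-%)

  φα-pt : ∀ {n} (α a b : Vec ℕ n) t s → IsPoint p k n α →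
    φα p α (pt a b (t + P * s)) ≈ φ-ray α (affine a b t) b s
  φα-pt []       []       []       t s VAll.[]                = ≈-refl
  φα-pt (α ∷ αs) (a ∷ as) (b ∷ bs) t s (α<p^k VAll.∷ αs<p^k) =
    *-cong φ≈binom (φα-pt αs as bs t s αs<p^k)
    where
    x : ℕ
    x = a + (t + P * s) * b
    φ≈binom : φ p α (x % p ^ k) ≈ binom (ray (a + t * b) b s) α
    φ≈binom = begin
      ((x % p ^ k) C α) % p ≈⟨ %-≈ _ ⟩
      (x % p ^ k) C α       ≡⟨ binom≡C (x % p ^ k) α ⟨
      binom (x % p ^ k) α   ≈⟨ binom-% x α α<p^k ⟩
      binom x α             ≡⟨ cong (λ y → binom y α) x≡ray ⟩
      binom (ray (a + t * b) b s) α ∎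
      where
      open ≈-Reasoning
      x≡ray : x ≡ ray (a + t * b) b s
      x≡ray = solve 5 (λ a t P s b → a :+ (t :+ P :* s) :* b := a :+ t :* b :+ P :* (s :* b)) refl a t P s b

  combRaySum : ∀ {n} → List (ℕ × Vec ℕ n) → Vec ℕ n → Vec ℕ n → ℕ
  combRaySum terms y b = sum (List.map (λ (c , α) → c * raySum α y b) terms)

  sum-evalComb-pt : ∀ {n} (a b : Vec ℕ n) t terms → LAll.All (IsPoint p k n ∘ proj₂) terms →
    ∑[ s < M ] evalComb p terms (pt a b (t + P * s)) ≈ combRaySum terms (affine a b t) b
  sum-evalComb-pt a b t []             LAll.[]            = ≡⇒≈ (sumBelow-zero M)
  sum-evalComb-pt a b t ((c , α) ∷ ts) (α-pt LAll.∷ ts-pt) = begin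
    ∑[ s < M ] (c * φα p α (pt a b (t + P * s)) + evalComb p ts (pt a b (t + P * s)))
      ≡⟨ sumBelow-+ M _ _ ⟩
    ∑[ s < M ] (c * φα p α (pt a b (t + P * s))) + ∑[ s < M ] evalComb p ts (pt a b (t + P * s))
      ≡⟨ cong (_+ _) (sumBelow-*ˡ M c _) ⟩
    c * ∑[ s < M ] φα p α (pt a b (t + P * s)) + ∑[ s < M ] evalComb p ts (pt a b (t + P * s))
      ≈⟨ +-cong (*-cong (≈-refl {c}) (sumBelow-cong≈ M (λ s _ → φα-pt α a b t s α-pt)))
                (sum-evalComb-pt a b t ts ts-pt) ⟩
    c * raySum α (affine a b t) b + combRaySum ts (affine a b t) b
      ∎
    where open ≈-Reasoning

  combRaySum-cong : ∀ {n} terms (b : Vec ℕ n) {y y′} → LAll.All (λ (_ , α) → highPart α < M) terms →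
    y ≋ y′ → combRaySum terms y b ≈ combRaySum terms y′ b
  combRaySum-cong []             b LAll.[]             y≋y′ = ≈-refl
  combRaySum-cong ((c , α) ∷ ts) b (α<M LAll.∷ ts<M) y≋y′ =
    +-cong (*-cong (≈-refl {c}) (raySum-cong α b α<M y≋y′)) (combRaySum-cong ts b ts<M y≋y′)

  P*highPart≤∣∣ : ∀ {n} (α : Vec ℕ n) → P * highPart α ≤ ∣ α ∣ₘ
  P*highPart≤∣∣ []       = ≤-reflexive (*-zeroʳ P)
  P*highPart≤∣∣ (α ∷ αs) = begin
    P * (α / P + highPart αs)        ≡⟨ *-distribˡ-+ P (α / P) (highPart αs) ⟩
    P * (α / P) + P * highPart αs    ≡⟨ cong (_+ P * highPart αs) (*-comm P (α / P)) ⟩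
    α / P * P + P * highPart αs      ≤⟨ +-mono-≤ (m/n*n≤m α P) (P*highPart≤∣∣ αs) ⟩
    α + ∣ αs ∣ₘ                      ∎
    where open ≤-Reasoning

  highPart<M : ∀ {n} (α : Vec ℕ n) → ∣ α ∣ₘ ≤ p ^ k ∸ 1 → highPart α < M
  highPart<M α ∣α∣<p^k = *-cancelˡ-< P (highPart α) M (begin-strict
    P * highPart α   ≤⟨ P*highPart≤∣∣ α ⟩
    ∣ α ∣ₘ            ≤⟨ ∣α∣<p^k ⟩
    p ^ k ∸ 1        <⟨ ∸-monoʳ-< z<s (m^n>0 p k) ⟩
    p ^ k            ≡⟨ p^k≡P*M ⟩
    P * M            ∎)
    where open ≤-Reasoning

  sumLineCube≈combRaySum : ∀ {n} (a b c : Vec ℕ n) → HasUnitCoord p n b →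
    ∀ {x} → T (onLine p k a b x ∧ inCube p ℓ c x) →
    ∀ f terms → LAll.All (IsPoint p k n ∘ proj₂) terms →
    (∀ x → IsPoint p k n x → f x ≈ evalComb p terms x) →
    ∃ λ y → c ≋ y × sumLineCube p k ℓ a b c f ≈ combRaySum terms y b
  sumLineCube≈combRaySum a b c unit {x} x∈L∩Q f terms terms-pt f≈comb
    with Equivalence.to T-∧ x∈L∩Q
  ... | x∈L , x∈Q with onLine⁻ a b {x} x∈L
  ... | t₀ , _ , refl = affine a b r , base∈cube , (begin
    sumLineCube p k ℓ a b c f                ≡⟨ sumLineCube≡ f ⟩
    ∑[ s < M ] f (cubePt s)                  ≈⟨ sumBelow-cong≈ M (λ s _ → f≈comb (cubePt s) (cubePt-IsPoint s)) ⟩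
    ∑[ s < M ] evalComb p terms (cubePt s)   ≈⟨ sum-evalComb-pt a b r terms terms-pt ⟩
    combRaySum terms (affine a b r) b        ∎)
    where
    open LineThroughCube a b c unit {t₀} (inCube⁻ c (pt a b t₀) x∈Q)
    open ≈-Reasoning

proposition8p12 : (p k n ℓ : ℕ) .{{_ : NonZero p}} → Prime p → ℓ < k →
    (c : Vec ℕ n) → IsPoint p k n c →
    (b : Vec ℕ n) → IsPoint p k n b → HasUnitCoord p n b →
    (a a′ : Vec ℕ n) → IsPoint p k n a → IsPoint p k n a′ →
    Σ (Vec ℕ n) (λ x → IsPoint p k n x × T (onLine p k a b x ∧ inCube p ℓ c x)) →
    Σ (Vec ℕ n) (λ x → IsPoint p k n x × T (onLine p k a′ b x ∧ inCube p ℓ c x)) →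
    (f : Vec ℕ n → ℕ) → InΩ p k n (p ^ k ∸ 1) f →
    sumLineCube p k ℓ a b c f % p ≡ sumLineCube p k ℓ a′ b c f % p
-- The coordinates of a, a′, b, c need not be reduced: linePt and inCube only see them modulo p^k.
proposition8p12 p k n ℓ p-prime ℓ<k c _ b _ unit a a′ _ _ (_ , _ , x∈L∩Q) (_ , _ , x′∈L′∩Q) f
                (terms , bounds , f≈comb) =
  let y  , c≋y  , sum≈  = sumLineCube≈combRaySum a  b c unit x∈L∩Q  f terms terms-pt f≈comb
      y′ , c≋y′ , sum′≈ = sumLineCube≈combRaySum a′ b c unit x′∈L′∩Q f terms terms-pt f≈comb
  in begin
    sumLineCube p k ℓ a b c f    ≈⟨ sum≈ ⟩
    combRaySum terms y b         ≈⟨ combRaySum-cong terms b terms<M (≋-trans (≋-sym c≋y) c≋y′) ⟩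
    combRaySum terms y′ b        ≈⟨ sum′≈ ⟨
    sumLineCube p k ℓ a′ b c f   ∎
  where
  open LinesInCubes p-prime (<⇒≤ ℓ<k)
  open Congruence p using (module ≈-Reasoning)
  open ≈-Reasoning
  terms-pt : LAll.All (IsPoint p k n ∘ proj₂) terms
  terms-pt = LAll.map proj₁ bounds
  terms<M : LAll.All (λ (_ , α) → highPart α < M) terms
  terms<M = LAll.map (λ {(_ , α)} (_ , ∣α∣≤) → highPart<M α ∣α∣≤) bounds
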